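{- Let $X$ be self-similar with respect to $F$ and satisfy Axiom (S1). Then for every $v\in F$, \[\operatorname{cells}_X v\cdot(\theta_X-1)=\deg_{X_F}v,\] where $\operatorname{cells}_X v$ is the number of cells $C$ with $v\in\theta C$.
   Context: Graphs are connected, locally finite, infinite, undirected, without loops or multiple edges. For $C\subseteq VX$, $\theta C$ is the set of vertices of $VX\setminus C$ adjacent to a vertex of $C$, $\overline C=C\cup\theta C$. For $F\subseteq VX$, $\mathcal{C}_X(F)$ is the set of connected components (as vertex sets) of the subgraph induced on $VX\setminus F$; these are the cells. The reduced graph $X_F$ has vertex set $F$, distinct $x,y$ adjacent iff $x,y\in\theta C$ for some $C\in\mathcal{C}_X(F)$. $X$ is self-similar with respect to $F$ if (F1) no two vertices of $F$ are adjacent in $X$, (F2) distinct $C,D\in\mathcal{C}_X(F)$ satisfy $|\overline C\cap\overline D|\le1$, (F3) there is a graph isomorphism $X\to X_F$. For a cell $C$, $\hat C$ is the subgraph induced on $\overline C$. Axiom (S1): all cells are finite and for any two cells $C,D$ there is a graph isomorphism $\alpha:\hat C\to\hat D$ with $\alpha(\theta C)=\theta D$. Under (S1), $\theta_X:=|\theta C|$ does not depend on $C$. -}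

module Defs where

open import Data.Nat using (ℕ)
open import Data.Fin using (Fin)
open import Data.List using (List)
open import Data.List.Membership.Propositional using (_∈_)
open import Data.Product using (Σ; ∃; _×_; _,_)
open import Relation.Nullary using (¬_)
open import Relation.Binary.PropositionalEquality using (_≡_; _≢_)
open import Data.Sum using (_⊎_)
open import Function.Bundles using (_⇔_)
open import Level using (_⊔_)
open import Function.Definitions using (Injective)

Subset : Set → Set₁
Subset V = V → Set

_≐_ : {V : Set} → Subset V → Subset V → Set
A ≐ B = ∀ x → (A x ⇔ B x)

data WalkIn {V : Set} (_~_ : V → V → Set) (S : Subset V) : V → V → Set where
  here : ∀ {x} → S x → WalkIn _~_ S x x
  step : ∀ {x y z} → S x → x ~ y → WalkIn _~_ S y z → WalkIn _~_ S x z

record Graph : Set₁ where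
  field
    V             : Set
    _~_           : V → V → Set
    ~-sym         : ∀ {x y} → x ~ y → y ~ x
    ~-irrefl      : ∀ {x} → ¬ (x ~ x)
    connected     : ∀ x y → WalkIn _~_ (λ _ → V) x y
    locallyFinite : ∀ x → Σ (List V) (λ ns → ∀ y → (x ~ y ⇔ y ∈ ns))
    infinite      : Σ (ℕ → V) (λ f → Injective _≡_ _≡_ f)

HasSize : ∀ {ℓ} {A : Set} → (A → Set ℓ) → ℕ → Set ℓ
HasSize {A = A} P n =
  Σ (Fin n → A) λ f →
    Injective _≡_ _≡_ f × (∀ i → P (f i)) × (∀ y → P y → ∃ λ i → f i ≡ y)

module _ (X : Graph) where
  open Graph X

  θ : Subset V → Subset V
  θ C y = ¬ C y × ∃ λ x → C x × x ~ y

  closure : Subset V → Subset V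
  closure C y = C y ⊎ θ C y

  ∁ : Subset V → Subset V
  ∁ F x = ¬ F x

  -- C is a cell of F: a connected component (as a vertex set) of the
  -- subgraph induced on V ∖ F.
  IsCell : Subset V → Subset V → Set
  IsCell F C = (∃ λ x → C x)
             × (∀ x → C x → ¬ F x)
             × (∀ x y → C x → (C y ⇔ WalkIn _~_ (∁ F) x y))

  _~[_]_ : V → Subset V → V → Set₁
  x ~[ F ] y = F x × F y × x ≢ y
             × ∃ λ C → IsCell F C × θ C x × θ C y

  F1 : Subset V → Set
  F1 F = ∀ x y → F x → F y → ¬ (x ~ y)

  F2 : Subset V → Set₁
  F2 F = ∀ C D → IsCell F C → IsCell F D → ¬ (C ≐ D) →
         ∀ x y → closure C x → closure D x → closure C y → closure D y → x ≡ y

  F3 : Subset V → Set₁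
  F3 F = Σ (V → V) λ φ →
           (∀ x → F (φ x))
         × Injective _≡_ _≡_ φ
         × (∀ y → F y → ∃ λ x → φ x ≡ y)
         × (∀ x y → (x ~ y ⇔ φ x ~[ F ] φ y))

  SelfSimilar : Subset V → Set₁
  SelfSimilar F = F1 F × F2 F × F3 F

  -- Isomorphism of induced subgraphs Ĉ → D̂ mapping θ C onto θ D,
  -- given as a map α : V → V restricted to C̄.
  CellIso : Subset V → Subset V → Set
  CellIso C D = Σ (V → V) λ α →
      (∀ x → closure C x → closure D (α x))
    × (∀ x y → closure C x → closure C y → α x ≡ α y → x ≡ y)
    × (∀ y → closure D y → ∃ λ x → closure C x × α x ≡ y)
    × (∀ x y → closure C x → closure C y → (x ~ y ⇔ α x ~ α y))
    × (∀ x → closure C x → (θ C x ⇔ θ D (α x)))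

  S1 : Subset V → Set₁
  S1 F = (∀ C → IsCell F C → ∃ λ n → HasSize C n)
       × (∀ C D → IsCell F C → IsCell F D → CellIso C D)

  CellsCount : Subset V → V → ℕ → Set₁
  CellsCount F v n =
    Σ (Fin n → Subset V) λ Cs →
        (∀ i → IsCell F (Cs i) × θ (Cs i) v)
      × (∀ i j → Cs i ≐ Cs j → i ≡ j)
      × (∀ D → IsCell F D → θ D v → ∃ λ i → Cs i ≐ D)

  DegreeF : Subset V → V → ℕ → Set₁
  DegreeF F v n = HasSize (λ y → v ~[ F ] y) n

-- The cells having v on their boundary form a "star" at v: each has a
-- boundary of t vertices, one of which is v, and by (F2) two of them share no
-- other boundary vertex.  The neighbours of v in X_F are exactly the other
-- boundary vertices of these cells, so there are c · (t − 1) of them.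
module Submission where

open import Defs
open import Data.Nat using (ℕ; zero; suc; _*_; _∸_; _≤_)
open import Data.Nat.Properties using (≤-antisym; *-zeroʳ) renaming (_≟_ to _≟ℕ_)
open import Data.Fin using (Fin; combine; remQuot; punchIn; punchOut)
open import Data.Fin.Properties
  using (injective⇒≤; combine-injective; combine-remQuot; punchIn-injective; punchInᵢ≢i; punchOut-injective)
  renaming (_≟_ to _≟Fin_)
open import Data.Product using (_×_; _,_; proj₁; proj₂; ∃; ∃₂; uncurry)
open import Data.Sum using (inj₂)
open import Function.Base using (_∘_)
open import Function.Bundles using (_⇔_; mk⇔; Equivalence)
open import Function.Definitions using (Injective)
open import Relation.Nullary using (¬_; yes; no; contradiction)
open import Relation.Nullary.Decidable using (decidable-stable)
open import Relation.Binary.PropositionalEquality using (_≡_; _≢_; refl; sym; trans; cong; cong₂)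

HasSize-cong : ∀ {ℓ ℓ′} {A : Set} {P : A → Set ℓ} {Q : A → Set ℓ′} {n} →
               (∀ x → P x ⇔ Q x) → HasSize P n → HasSize Q n
HasSize-cong P⇔Q (f , f-inj , f-sound , f-complete) =
  f , f-inj , (λ i → Equivalence.to (P⇔Q (f i)) (f-sound i)) ,
  (λ y Qy → f-complete y (Equivalence.from (P⇔Q y) Qy))

Injective₂ : ∀ {A B C : Set} → (A → B → C) → Set
Injective₂ f = ∀ {a b a′ b′} → f a b ≡ f a′ b′ → a ≡ a′ × b ≡ b′

injective₂⇒*≤ : ∀ {m n k} (f : Fin m → Fin n → Fin k) → Injective₂ f → m * n ≤ k
injective₂⇒*≤ {m} {n} f f-inj = injective⇒≤ {f = uncurry f ∘ remQuot n} λ {a} {b} eq →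
  let a₁≡b₁ , a₂≡b₂ = f-inj eq in
  trans (sym (combine-remQuot {m} n a))
        (trans (cong₂ combine a₁≡b₁ a₂≡b₂) (combine-remQuot {m} n b))

≤*-injective₂ : ∀ {m n k} (f : Fin k → Fin m) (g : Fin k → Fin n) →
                (∀ {a b} → f a ≡ f b → g a ≡ g b → a ≡ b) → k ≤ m * n
≤*-injective₂ f g fg-inj = injective⇒≤ {f = λ a → combine (f a) (g a)} λ {a} {b} eq →
  uncurry fg-inj (combine-injective (f a) (g a) (f b) (g b) eq)

record Wedge (A : Set) (v : A) (c t : ℕ) : Set where
  field
    elem      : Fin c → Fin t → A
    injective : ∀ i → Injective _≡_ _≡_ (elem i)
    base      : Fin c → Fin t
    elem-base : ∀ i → elem i (base i) ≡ v
    disjoint  : ∀ {i j k l} → i ≢ j → elem i k ≡ elem j l → elem i k ≡ v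

  Punctured : A → Set
  Punctured y = v ≢ y × ∃₂ λ i k → elem i k ≡ y

module _ {A : Set} {v : A} {c s : ℕ} (W : Wedge A v c (suc s)) where
  open Wedge W

  private
    base≢ : ∀ {i k} → v ≢ elem i k → base i ≢ k
    base≢ {i} v≢ eq = v≢ (trans (sym (elem-base i)) (cong (elem i) eq))

    v≢elem-punchIn : ∀ i k → v ≢ elem i (punchIn (base i) k)
    v≢elem-punchIn i k eq =
      punchInᵢ≢i (base i) k (injective i (trans (sym eq) (sym (elem-base i))))

  punctured-size-≤ : ∀ {d} → HasSize Punctured d → d ≤ c * s
  punctured-size-≤ (g , g-inj , g-sound , _) = ≤*-injective₂ index offset offset-inj
    where
    index : Fin _ → Fin c
    index j = proj₁ (proj₂ (g-sound j))
    position : ∀ j → Fin (suc s)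
    position j = proj₁ (proj₂ (proj₂ (g-sound j)))
    elem≡g : ∀ j → elem (index j) (position j) ≡ g j
    elem≡g j = proj₂ (proj₂ (proj₂ (g-sound j)))
    base≢position : ∀ j → base (index j) ≢ position j
    base≢position j = base≢ λ eq → proj₁ (g-sound j) (trans eq (elem≡g j))
    offset : Fin _ → Fin s
    offset j = punchOut (base≢position j)
    offset-inj : ∀ {a b} → index a ≡ index b → offset a ≡ offset b → a ≡ b
    offset-inj {a} {b} i≡ o≡ = g-inj (trans (sym (elem≡g a))
      (trans (same i≡ (base≢position a) (base≢position b) o≡) (elem≡g b)))
      where
      same : ∀ {i i′ k k′} → i ≡ i′ → (p : base i ≢ k) (q : base i′ ≢ k′) →
             punchOut p ≡ punchOut q → elem i k ≡ elem i′ k′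
      same {i} refl p q eq = cong (elem i) (punchOut-injective p q eq)

  punctured-size-≥ : ∀ {d} → HasSize Punctured d → c * s ≤ d
  punctured-size-≥ {d} (g , g-inj , _ , g-complete) = injective₂⇒*≤ f f-inj
    where
    other : Fin c → Fin s → A
    other i k = elem i (punchIn (base i) k)
    located : ∀ i k → ∃ λ j → g j ≡ other i k
    located i k = g-complete (other i k) (v≢elem-punchIn i k , i , punchIn (base i) k , refl)
    f : Fin c → Fin s → Fin d
    f i k = proj₁ (located i k)
    other-inj : Injective₂ other
    other-inj {i} {k} {i′} {k′} eq with i ≟Fin i′
    ... | yes refl = refl , punchIn-injective (base i) k k′ (injective i eq)
    ... | no i≢i′ = contradiction (sym (disjoint i≢i′ eq)) (v≢elem-punchIn i k)
    f-inj : Injective₂ f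
    f-inj {i} {k} {i′} {k′} eq =
      other-inj (trans (sym (proj₂ (located i k))) (trans (cong g eq) (proj₂ (located i′ k′))))

punctured-size : ∀ {A : Set} {v : A} {c t d} (W : Wedge A v c t) →
                 HasSize (Wedge.Punctured W) d → d ≡ c * (t ∸ 1)
punctured-size {c = c} {zero} {zero} W _ = sym (*-zeroʳ c)
punctured-size {t = zero} {suc d} W (_ , _ , g-sound , _) with g-sound Fin.zero
... | _ , _ , () , _
punctured-size {t = suc s} W size = ≤-antisym (punctured-size-≤ W size) (punctured-size-≥ W size)

module _ (X : Graph) (F : Subset (Graph.V X)) where
  open Graph X

  θ-resp-≐ : ∀ {C D} → C ≐ D → ∀ {y} → θ X C y → θ X D y
  θ-resp-≐ C≐D {y} (¬Cy , x , Cx , x~y) =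
    (λ Dy → ¬Cy (Equivalence.from (C≐D y) Dy)) , x , Equivalence.to (C≐D x) Cx , x~y

  ≐-sym : ∀ {C D : Subset V} → C ≐ D → D ≐ C
  ≐-sym C≐D x = mk⇔ (Equivalence.from (C≐D x)) (Equivalence.to (C≐D x))

  θ-cell⊆¬¬F : ∀ {C} → IsCell X F C → ∀ {y} → θ X C y → ¬ ¬ F y
  θ-cell⊆¬¬F (_ , C⊆∁F , C-walk) (¬Cy , x , Cx , x~y) ¬Fy =
    ¬Cy (Equivalence.from (C-walk x _ Cx) (step (C⊆∁F x Cx) x~y (here ¬Fy)))

  θ-cells-meet-once : F2 X F → ∀ {C D v y} → IsCell X F C → IsCell X F D → ¬ (C ≐ D) →
                      θ X C v → θ X D v → θ X C y → θ X D y → v ≡ y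
  θ-cells-meet-once f2 C-cell D-cell C≢D θCv θDv θCy θDy =
    f2 _ _ C-cell D-cell C≢D _ _ (inj₂ θCv) (inj₂ θDv) (inj₂ θCy) (inj₂ θDy)

  module Star (f2 : F2 X F) {t} (θ-size : ∀ C → IsCell X F C → HasSize (θ X C) t)
              {v} (Fv : F v) {c} (cells : CellsCount X F v c) where

    cell : Fin c → Subset V
    cell = proj₁ cells

    cell-isCell : ∀ i → IsCell X F (cell i)
    cell-isCell i = proj₁ (proj₁ (proj₂ cells) i)

    θcell-v : ∀ i → θ X (cell i) v
    θcell-v i = proj₂ (proj₁ (proj₂ cells) i)

    θcell-size : ∀ i → HasSize (θ X (cell i)) t
    θcell-size i = θ-size (cell i) (cell-isCell i)

    boundary : Fin c → Fin t → V
    boundary i = proj₁ (θcell-size i)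

    θcell-boundary : ∀ i k → θ X (cell i) (boundary i k)
    θcell-boundary i = proj₁ (proj₂ (proj₂ (θcell-size i)))

    boundary-complete : ∀ i {y} → θ X (cell i) y → ∃ λ k → boundary i k ≡ y
    boundary-complete i = proj₂ (proj₂ (proj₂ (θcell-size i))) _

    cells-disjoint : ∀ {i j k l} → i ≢ j → boundary i k ≡ boundary j l → boundary i k ≡ v
    cells-disjoint {i} {j} {k} {l} i≢j eq = sym (θ-cells-meet-once f2
      (cell-isCell i) (cell-isCell j) (i≢j ∘ proj₁ (proj₂ (proj₂ cells)) i j)
      (θcell-v i) (θcell-v j) (θcell-boundary i k) θcell-j)
      where
      θcell-j : θ X (cell j) (boundary i k)
      θcell-j rewrite eq = θcell-boundary j l

    star : Wedge V v c t
    star = record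
      { elem      = boundary
      ; injective = λ i → proj₁ (proj₂ (θcell-size i))
      ; base      = λ i → proj₁ (boundary-complete i (θcell-v i))
      ; elem-base = λ i → proj₂ (boundary-complete i (θcell-v i))
      ; disjoint  = cells-disjoint
      }

    neighbour⇔punctured : (∀ i k → F (boundary i k)) →
                          ∀ y → _~[_]_ X v F y ⇔ Wedge.Punctured star y
    neighbour⇔punctured boundary⊆F y = mk⇔ to from
      where
      to : _~[_]_ X v F y → Wedge.Punctured star y
      to (_ , _ , v≢y , C , C-cell , θCv , θCy) =
        let i , cell-i≐C = proj₂ (proj₂ (proj₂ cells)) C C-cell θCv
            k , boundary≡y = boundary-complete i (θ-resp-≐ (≐-sym cell-i≐C) θCy)
        in v≢y , i , k , boundary≡y
      from : Wedge.Punctured star y → _~[_]_ X v F y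
      from (v≢y , i , k , refl) =
        Fv , boundary⊆F i k , v≢y , cell i , cell-isCell i , θcell-v i , θcell-boundary i k

¬¬-∀-Fin : ∀ {n} {P : Fin n → Set} → (∀ i → ¬ ¬ P i) → ¬ ¬ (∀ i → P i)
¬¬-∀-Fin {zero}  _      ¬∀ = ¬∀ λ ()
¬¬-∀-Fin {suc n} ¬¬P ¬∀ =
  ¬¬P Fin.zero λ P₀ → ¬¬-∀-Fin (¬¬P ∘ Fin.suc) λ P₊ → ¬∀ λ { Fin.zero → P₀ ; (Fin.suc i) → P₊ i }

lemma3p2 : (X : Graph) → (F : Graph.V X → Set) →
           SelfSimilar X F → S1 X F →
           -- θ_X = t : the common size of θ C over cells C
           (t : ℕ) → (∀ C → IsCell X F C → HasSize (θ X C) t) →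
           ∀ v → F v → (c d : ℕ) →
           CellsCount X F v c → DegreeF X F v d →
           c * (t ∸ 1) ≡ d
-- F is an arbitrary predicate, so θ C ⊆ F only holds doubly negated; the goal
-- is a decidable equation, which makes that enough.
lemma3p2 X F (_ , f2 , _) _ t θ-size v Fv c d cells degree =
  decidable-stable (c * (t ∸ 1) ≟ℕ d) λ ≢d →
    ¬¬-∀-Fin (λ i → ¬¬-∀-Fin λ k → θ-cell⊆¬¬F X F (cell-isCell i) (θcell-boundary i k))
      λ boundary⊆F →
      ≢d (sym (punctured-size star (HasSize-cong (neighbour⇔punctured boundary⊆F) degree)))
  where open Star X F f2 θ-size Fv cells
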